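{- Let $G$ be a connected circle graph and let $A, B, \mathfrak{s}(A), \mathfrak{s}(B)$ be a split of $G$. Let $\mathcal{R}$ be a circle representation of $G$ with circular word $\tau$, and let $\gamma$ be the circular subsequence of $\tau$ induced by the symbols of $A \cup B$. Write $\gamma = \gamma_1\gamma_2\cdots\gamma_{2k}$, where $\gamma_1,\dots,\gamma_{2k}$ are, in circular order, the maximal subwords of $\gamma$ consisting only of symbols from $A$ or only of symbols from $B$, numbered so that $\gamma_1$ consists of symbols from $A$ (so the odd-indexed words consist of symbols of $A$ and the even-indexed words of symbols of $B$). Indices are taken modulo $2k$. Then: (a) each $\gamma_i$ contains each symbol at most once; (b) for every $i$, the opposite words $\gamma_i$ and $\gamma_{i+k}$ contain the same set of symbols; (c) if $j \notin \{i, i+k\}$, $x$ is a symbol in $\gamma_i$ and $y$ is a symbol in $\gamma_j$, then $xy \in E(G)$.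
   Context: A circle representation of a graph $G$ assigns to each vertex $v$ a chord $C_v$ of a fixed circle, all $2|V(G)|$ endpoints being distinct, such that $C_u$ and $C_v$ intersect if and only if $uv \in E(G)$. Reading the endpoints around the circle and labelling each endpoint by its vertex gives a circular word $\tau$ in which every vertex occurs exactly twice; $uv \in E(G)$ iff the two occurrences of $u$ and the two occurrences of $v$ alternate in $\tau$. A circle graph is a graph admitting a circle representation. A split of a connected graph $G$ is a partition of $V(G)$ into four parts $A, B, \mathfrak{s}(A), \mathfrak{s}(B)$ such that: every $a\in A$ and $b \in B$ satisfy $ab \in E(G)$; there is no edge between $\mathfrak{s}(A)$ and $B \cup \mathfrak{s}(B)$, and no edge between $\mathfrak{s}(B)$ and $A \cup \mathfrak{s}(A)$; and $|A \cup \mathfrak{s}(A)| \ge 2$, $|B \cup \mathfrak{s}(B)| \ge 2$. -}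

module Defs where

open import Data.Nat using (ℕ; zero; suc; _+_; _<_; _≤_; _%_)
open import Data.Fin using (Fin; toℕ; splitAt; _↑ˡ_; _↑ʳ_)
import Data.Fin.Properties as FinP
open import Data.List using (List; []; _∷_; length; lookup; filterᵇ; drop; take; _++_; concat; tabulate)
open import Data.List.Membership.Propositional using (_∈_)
open import Data.Bool using (Bool; true; false)
open import Data.Product using (Σ; ∃; _×_; _,_)
open import Data.Sum using (_⊎_; inj₁; inj₂; [_,_])
open import Relation.Nullary using (¬_)
open import Relation.Binary.PropositionalEquality using (_≡_; _≢_)
open import Function.Bundles using (_⇔_)

record Graph (n : ℕ) : Set₁ where
  field
    Adj     : Fin n → Fin n → Set
    sym     : ∀ {u v} → Adj u v → Adj v u
    irrefl  : ∀ {u} → ¬ Adj u u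
open Graph public

data Reach {n : ℕ} (G : Graph n) : Fin n → Fin n → Set where
  here : ∀ {u} → Reach G u u
  step : ∀ {u w v} → Adj G u w → Reach G w v → Reach G u v

Connected : ∀ {n} → Graph n → Set
Connected {n} G = ∀ (u v : Fin n) → Reach G u v

-- Circle representations, as circular words.
-- A circular word is given by a linear word (list) read from an
-- arbitrary starting point on the circle.

occ : ∀ {n} → Fin n → List (Fin n) → ℕ
occ v [] = 0
occ v (x ∷ xs) with FinP._≟_ v x
... | Relation.Nullary.yes _ = suc (occ v xs)
... | Relation.Nullary.no  _ = occ v xs

-- u and v alternate in the (circular) word τ: reading linearly, we see
-- u … v … u … v  or  v … u … v … u  (these are exactly the linear
-- readings of a circular alternation).
Alternate : ∀ {n} → List (Fin n) → Fin n → Fin n → Set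
Alternate τ u v =
  Σ (Fin (length τ)) λ p → Σ (Fin (length τ)) λ q →
  Σ (Fin (length τ)) λ r → Σ (Fin (length τ)) λ s →
    (toℕ p < toℕ q) × (toℕ q < toℕ r) × (toℕ r < toℕ s) ×
    (   (lookup τ p ≡ u × lookup τ q ≡ v × lookup τ r ≡ u × lookup τ s ≡ v)
      ⊎ (lookup τ p ≡ v × lookup τ q ≡ u × lookup τ r ≡ v × lookup τ s ≡ u))

record CircleRep {n : ℕ} (G : Graph n) (τ : List (Fin n)) : Set where
  field
    twice : ∀ (v : Fin n) → occ v τ ≡ 2
    edges : ∀ (u v : Fin n) → Adj G u v ⇔ Alternate τ u v

data Part : Set where
  pA pB psA psB : Part

record IsSplit {n : ℕ} (G : Graph n) (part : Fin n → Part) : Set where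
  field
    complete : ∀ a b → part a ≡ pA → part b ≡ pB → Adj G a b
    noEdgeSA : ∀ x y → part x ≡ psA → (part y ≡ pB ⊎ part y ≡ psB) → ¬ Adj G x y
    noEdgeSB : ∀ x y → part x ≡ psB → (part y ≡ pA ⊎ part y ≡ psA) → ¬ Adj G x y
    sizeA : Σ (Fin n) λ x → Σ (Fin n) λ y → x ≢ y ×
              (part x ≡ pA ⊎ part x ≡ psA) × (part y ≡ pA ⊎ part y ≡ psA)
    sizeB : Σ (Fin n) λ x → Σ (Fin n) λ y → x ≢ y ×
              (part x ≡ pB ⊎ part x ≡ psB) × (part y ≡ pB ⊎ part y ≡ psB)

inAB : Part → Bool
inAB pA = true
inAB pB = true
inAB psA = false
inAB psB = false

induced : ∀ {n} → (Fin n → Part) → List (Fin n) → List (Fin n)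
induced part τ = filterᵇ (λ v → inAB (part v)) τ

rotate : ∀ {A : Set} → ℕ → List A → List A
rotate r xs = drop r xs ++ take r xs

-- the index opposite to i modulo 2k, i.e. i + k mod 2k
-- (0-based indices in Fin (k + k))
opp : ∀ k → Fin (k + k) → Fin (k + k)
opp k i = [ (λ a → k ↑ʳ a) , (λ b → b ↑ˡ k) ] (splitAt k i)

-- Blocks are indexed 0-based
-- by Fin (k + k); 0-based index i corresponds to γ_{i+1}, so blocks with
-- even 0-based index consist of symbols of A and odd ones of B.
-- Nonempty alternating blocks arranged circularly are automatically maximal.
record BlockDecomp {n : ℕ} (part : Fin n → Part) (γ : List (Fin n))
                   (k : ℕ) (blocks : Fin (k + k) → List (Fin n)) : Set where
  field
    nonempty : ∀ i → blocks i ≢ []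
    evenA    : ∀ i → toℕ i % 2 ≡ 0 → ∀ x → x ∈ blocks i → part x ≡ pA
    oddB     : ∀ i → toℕ i % 2 ≡ 1 → ∀ x → x ∈ blocks i → part x ≡ pB
    circ     : Σ ℕ λ r → rotate r γ ≡ concat (tabulate blocks)

module Submission where

-- Read γ from the start of γ₁ and call the resulting word w; its blocks are the γᵢ.  Every
-- symbol of A ∪ B occurs twice in w, and since A is complete to B, any two symbols of opposite
-- sides alternate in w.
--
-- (a) If x occurred twice in one block, every symbol of the other side would have to occur
-- between the two copies, hence in that same block, which is absurd.  So every symbol lies in
-- exactly two blocks.  Its gap, seen from one of them, is the number of steps forward on the
-- cycle of 2k blocks to the other one.
--
-- (b) A symbol x in block t and a symbol y in block t + 1 are on opposite sides, so their chords
-- cross; then the gap of y seen from t + 1 is at least the gap of x seen from t.  Going once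
-- around the cycle shows that all gaps are equal, and as the two gaps of one symbol add up to
-- 2k, every gap is k.
--
-- (c) Now x lies in blocks a and a + k, y in b and b + k with a ≠ b, a, b < k; these four
-- blocks interleave, so x and y alternate and are adjacent.

open import Data.Bool using (Bool; true; false; T; T?)
open import Data.Empty using (⊥-elim)
open import Data.Nat using (ℕ; zero; suc; _+_; _∸_; _≤_; _<_; _%_; _≤?_; z≤n; s≤s; z<s; ⌊_/2⌋; +-0-rawMonoid)
open import Data.Nat.Properties
open import Data.Fin using (Fin; zero; suc; toℕ; fromℕ; fromℕ<; splitAt; join)
import Data.Fin.Properties as Fin
open import Data.List using (List; []; _∷_; _++_; length; lookup; filterᵇ; take; drop; concat; tabulate)
open import Data.List.Properties using (take++drop≡id; filter-all)
open import Data.List.Membership.Propositional using (_∈_)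
open import Data.List.Relation.Unary.Any using (here; there)
open import Data.List.Relation.Unary.All using (All; []; _∷_)
import Data.List.Relation.Unary.All as All
open import Data.List.Relation.Unary.AllPairs using ([]; _∷_)
open import Data.List.Relation.Unary.Unique.Propositional using (Unique)
open import Data.List.Relation.Binary.Sublist.Propositional
  using (_⊆_; []; _∷_; _∷ʳ_; ⊆-trans; minimum; from∈; to∈)
open import Data.List.Relation.Binary.Sublist.Propositional.Properties
  using (++⁺; ∷ˡ⁻; filter-⊆; filter⁺)
open import Data.Product using (∃; ∃₂; _×_; _,_; proj₁; proj₂)
open import Data.Sum using (_⊎_; inj₁; inj₂; [_,_]′; swap)
open import Data.Sum.Properties using (swap-involutive)
open import Data.Unit using (tt)
open import Function using (_∘_; case_of_)
open import Function.Bundles using (_⇔_; mk⇔; Equivalence)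
open import Relation.Nullary using (yes; no)
open import Relation.Binary using (tri<; tri≈; tri>)
open import Relation.Binary.PropositionalEquality
open import Defs hiding (sym)
open import Algebra.Definitions.RawMonoid +-0-rawMonoid using (sum)

-- Alternation in words

module _ {A : Set} where

  ⊆-++-split : ∀ ys {zs xs : List A} → xs ⊆ ys ++ zs →
               ∃₂ λ xs₁ xs₂ → xs₁ ++ xs₂ ≡ xs × xs₁ ⊆ ys × xs₂ ⊆ zs
  ⊆-++-split []       s          = [] , _ , refl , [] , s
  ⊆-++-split (y ∷ ys) (.y ∷ʳ s)  with ⊆-++-split ys s
  ... | xs₁ , xs₂ , refl , s₁ , s₂ = xs₁ , xs₂ , refl , y ∷ʳ s₁ , s₂
  ⊆-++-split (y ∷ ys) (refl ∷ s) with ⊆-++-split ys s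
  ... | xs₁ , xs₂ , refl , s₁ , s₂ = y ∷ xs₁ , xs₂ , refl , refl ∷ s₁ , s₂

  Alternating : List A → A → A → Set
  Alternating xs u v = u ∷ v ∷ u ∷ v ∷ [] ⊆ xs ⊎ v ∷ u ∷ v ∷ u ∷ [] ⊆ xs

  Alternating-sym : ∀ {xs u v} → Alternating xs u v → Alternating xs v u
  Alternating-sym (inj₁ s) = inj₂ s
  Alternating-sym (inj₂ s) = inj₁ s

  swap-uvuv : ∀ {u v : A} ws₁ ws₂ → ws₁ ++ ws₂ ≡ u ∷ v ∷ u ∷ v ∷ [] →
              ws₂ ++ ws₁ ≡ u ∷ v ∷ u ∷ v ∷ [] ⊎ ws₂ ++ ws₁ ≡ v ∷ u ∷ v ∷ u ∷ []
  swap-uvuv []                   _ refl = inj₁ refl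
  swap-uvuv (_ ∷ [])             _ refl = inj₂ refl
  swap-uvuv (_ ∷ _ ∷ [])         _ refl = inj₁ refl
  swap-uvuv (_ ∷ _ ∷ _ ∷ [])     _ refl = inj₂ refl
  swap-uvuv (_ ∷ _ ∷ _ ∷ _ ∷ []) _ refl = inj₁ refl

  private
    uvuv⊆-swap : ∀ xs ys {u v} → u ∷ v ∷ u ∷ v ∷ [] ⊆ xs ++ ys → Alternating (ys ++ xs) u v
    uvuv⊆-swap xs ys s with ⊆-++-split xs s
    ... | ws₁ , ws₂ , e , s₁ , s₂ with swap-uvuv ws₁ ws₂ e
    ...   | inj₁ e′ = inj₁ (subst (_⊆ ys ++ xs) e′ (++⁺ s₂ s₁))
    ...   | inj₂ e′ = inj₂ (subst (_⊆ ys ++ xs) e′ (++⁺ s₂ s₁))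

  Alternating-++-comm : ∀ xs ys {u v} → Alternating (xs ++ ys) u v → Alternating (ys ++ xs) u v
  Alternating-++-comm xs ys (inj₁ s) = uvuv⊆-swap xs ys s
  Alternating-++-comm xs ys (inj₂ s) = Alternating-sym (uvuv⊆-swap xs ys s)

  Alternating-rotate⁺ : ∀ r xs {u v} → Alternating xs u v → Alternating (rotate r xs) u v
  Alternating-rotate⁺ r xs {u} {v} a = Alternating-++-comm (take r xs) (drop r xs)
    (subst (λ zs → Alternating zs u v) (sym (take++drop≡id r xs)) a)

  Alternating-rotate⁻ : ∀ r xs {u v} → Alternating (rotate r xs) u v → Alternating xs u v
  Alternating-rotate⁻ r xs {u} {v} a = subst (λ zs → Alternating zs u v) (take++drop≡id r xs)
    (Alternating-++-comm (drop r xs) (take r xs) a)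

  module _ (p : A → Bool) where

    ⊆-filterᵇ : ∀ {zs xs} → All (T ∘ p) zs → zs ⊆ xs → zs ⊆ filterᵇ p xs
    ⊆-filterᵇ {xs = xs} pzs s = subst (_⊆ filterᵇ p xs) (filter-all (T? ∘ p) pzs)
      (filter⁺ (T? ∘ p) (T? ∘ p) (λ { refl px → px }) s)

    Alternating-filterᵇ⁺ : ∀ {xs u v} → T (p u) → T (p v) →
                           Alternating xs u v → Alternating (filterᵇ p xs) u v
    Alternating-filterᵇ⁺ pu pv (inj₁ s) = inj₁ (⊆-filterᵇ (pu ∷ pv ∷ pu ∷ pv ∷ []) s)
    Alternating-filterᵇ⁺ pu pv (inj₂ s) = inj₂ (⊆-filterᵇ (pv ∷ pu ∷ pv ∷ pu ∷ []) s)

    Alternating-filterᵇ⁻ : ∀ {xs u v} → Alternating (filterᵇ p xs) u v → Alternating xs u v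
    Alternating-filterᵇ⁻ {xs} (inj₁ s) = inj₁ (⊆-trans s (filter-⊆ (T? ∘ p) xs))
    Alternating-filterᵇ⁻ {xs} (inj₂ s) = inj₂ (⊆-trans s (filter-⊆ (T? ∘ p) xs))

module _ {A : Set} where

  data LookupChain (xs : List A) : ℕ → List A → Set where
    []  : ∀ {lo} → LookupChain xs lo []
    at  : ∀ {lo z zs} (i : Fin (length xs)) → lo ≤ toℕ i → lookup xs i ≡ z →
          LookupChain xs (suc (toℕ i)) zs → LookupChain xs lo (z ∷ zs)

  private
    chain-there : ∀ {x xs lo zs} → LookupChain xs lo zs → LookupChain (x ∷ xs) (suc lo) zs
    chain-there []              = []
    chain-there (at i lo≤i e c) = at (suc i) (s≤s lo≤i) e (chain-there c)

    chain-tail : ∀ {x xs lo zs} → LookupChain (x ∷ xs) (suc lo) zs → LookupChain xs lo zs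
    chain-tail []                          = []
    chain-tail (at (suc i) (s≤s lo≤i) e c) = at i lo≤i e (chain-tail c)

    chain-lower : ∀ {xs lo lo′ zs} → lo′ ≤ lo → LookupChain xs lo zs → LookupChain xs lo′ zs
    chain-lower _      []              = []
    chain-lower lo′≤lo (at i lo≤i e c) = at i (≤-trans lo′≤lo lo≤i) e c

  LookupChain⇒⊆ : ∀ xs lo {zs} → LookupChain xs lo zs → zs ⊆ drop lo xs
  LookupChain⇒⊆ xs       lo       []                 = minimum _
  LookupChain⇒⊆ (x ∷ xs) (suc lo) c@(at _ _ _ _)     = LookupChain⇒⊆ xs lo (chain-tail c)
  LookupChain⇒⊆ (x ∷ xs) zero     (at zero _ refl c) = refl ∷ LookupChain⇒⊆ xs 0 (chain-tail c)
  LookupChain⇒⊆ (x ∷ xs) zero     (at (suc i) _ e c) =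
    x ∷ʳ LookupChain⇒⊆ xs 0 (at i z≤n e (chain-tail c))

  ⊆⇒LookupChain : ∀ {zs xs} → zs ⊆ xs → LookupChain xs 0 zs
  ⊆⇒LookupChain []         = []
  ⊆⇒LookupChain (y ∷ʳ s)   = chain-lower z≤n (chain-there (⊆⇒LookupChain s))
  ⊆⇒LookupChain (refl ∷ s) = at zero z≤n refl (chain-there (⊆⇒LookupChain s))

module _ {n : ℕ} {τ : List (Fin n)} {u v : Fin n} where

  Alternate⇒Alternating : Alternate τ u v → Alternating τ u v
  Alternate⇒Alternating (p , q , r , s , p<q , q<r , r<s , inj₁ (e₁ , e₂ , e₃ , e₄)) =
    inj₁ (LookupChain⇒⊆ τ 0 (at p z≤n e₁ (at q p<q e₂ (at r q<r e₃ (at s r<s e₄ [])))))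
  Alternate⇒Alternating (p , q , r , s , p<q , q<r , r<s , inj₂ (e₁ , e₂ , e₃ , e₄)) =
    inj₂ (LookupChain⇒⊆ τ 0 (at p z≤n e₁ (at q p<q e₂ (at r q<r e₃ (at s r<s e₄ [])))))

  Alternating⇒Alternate : Alternating τ u v → Alternate τ u v
  Alternating⇒Alternate (inj₁ s) with ⊆⇒LookupChain s
  ... | at p _ e₁ (at q p<q e₂ (at r q<r e₃ (at s r<s e₄ []))) =
    p , q , r , s , p<q , q<r , r<s , inj₁ (e₁ , e₂ , e₃ , e₄)
  Alternating⇒Alternate (inj₂ s) with ⊆⇒LookupChain s
  ... | at p _ e₁ (at q p<q e₂ (at r q<r e₃ (at s r<s e₄ []))) =
    p , q , r , s , p<q , q<r , r<s , inj₂ (e₁ , e₂ , e₃ , e₄)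

module _ {n : ℕ} where

  occ-++ : ∀ (v : Fin n) xs ys → occ v (xs ++ ys) ≡ occ v xs + occ v ys
  occ-++ v []       ys = refl
  occ-++ v (x ∷ xs) ys with v Fin.≟ x
  ... | yes _ = cong suc (occ-++ v xs ys)
  ... | no  _ = occ-++ v xs ys

  occ-rotate : ∀ (v : Fin n) r xs → occ v (rotate r xs) ≡ occ v xs
  occ-rotate v r xs = begin
    occ v (drop r xs ++ take r xs)        ≡⟨ occ-++ v (drop r xs) (take r xs) ⟩
    occ v (drop r xs) + occ v (take r xs) ≡⟨ +-comm (occ v (drop r xs)) _ ⟩
    occ v (take r xs) + occ v (drop r xs) ≡⟨ occ-++ v (take r xs) (drop r xs) ⟨
    occ v (take r xs ++ drop r xs)        ≡⟨ cong (occ v) (take++drop≡id r xs) ⟩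
    occ v xs                              ∎
    where open ≡-Reasoning

  occ-filterᵇ : ∀ (p : Fin n → Bool) {v} → T (p v) → ∀ xs → occ v (filterᵇ p xs) ≡ occ v xs
  occ-filterᵇ p     pv []       = refl
  occ-filterᵇ p {v} pv (x ∷ xs) with p x in px
  ... | true with v Fin.≟ x
  ...   | yes _ = cong suc (occ-filterᵇ p pv xs)
  ...   | no  _ = occ-filterᵇ p pv xs
  occ-filterᵇ p {v} pv (x ∷ xs) | false with v Fin.≟ x
  ...   | no  _    = occ-filterᵇ p pv xs
  ...   | yes refl = ⊥-elim (subst T px pv)

  ∈⇒0<occ : ∀ {v : Fin n} {xs} → v ∈ xs → 0 < occ v xs
  ∈⇒0<occ {v} {x ∷ xs} v∈ with v Fin.≟ x | v∈
  ... | yes _   | _         = s≤s z≤n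
  ... | no  v≢x | here v≡x  = ⊥-elim (v≢x v≡x)
  ... | no  _   | there v∈′ = ∈⇒0<occ v∈′

  0<occ⇒∈ : ∀ {v : Fin n} xs → 0 < occ v xs → v ∈ xs
  0<occ⇒∈ {v} (x ∷ xs) h with v Fin.≟ x
  ... | yes v≡x = here v≡x
  ... | no  _   = there (0<occ⇒∈ xs h)

  occ-concat : ∀ (v : Fin n) {m} (f : Fin m → List (Fin n)) →
               occ v (concat (tabulate f)) ≡ sum (λ i → occ v (f i))
  occ-concat v {zero}  f = refl
  occ-concat v {suc m} f =
    trans (occ-++ v (f zero) _) (cong (occ v (f zero) +_) (occ-concat v (f ∘ suc)))

  occ≤1⇒Unique : ∀ (xs : List (Fin n)) → (∀ v → occ v xs ≤ 1) → Unique xs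
  occ≤1⇒Unique []       _ = []
  occ≤1⇒Unique (x ∷ xs) h = All.tabulate x∉xs ∷ occ≤1⇒Unique xs occ-tail
    where
    x∉xs : ∀ {y} → y ∈ xs → x ≢ y
    x∉xs y∈ refl with h x
    ... | hx with x Fin.≟ x
    ...   | yes _   = <⇒≱ (s≤s (∈⇒0<occ y∈)) hx
    ...   | no  x≢x = x≢x refl
    occ-tail : ∀ v → occ v xs ≤ 1
    occ-tail v with h v
    ... | hv with v Fin.≟ x
    ...   | yes _ = ≤-trans (n≤1+n _) hv
    ...   | no  _ = hv

≤-sum : ∀ {m} (g : Fin m → ℕ) i → g i ≤ sum g
≤-sum g zero    = m≤m+n _ _
≤-sum g (suc i) = ≤-trans (≤-sum (g ∘ suc) i) (m≤n+m _ _)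

+≤-sum : ∀ {m} (g : Fin m → ℕ) {i j} → i ≢ j → g i + g j ≤ sum g
+≤-sum g {zero}  {zero}  i≢j = ⊥-elim (i≢j refl)
+≤-sum g {zero}  {suc j} _   = +-monoʳ-≤ (g zero) (≤-sum (g ∘ suc) j)
+≤-sum g {suc i} {zero}  _   =
  subst (_≤ sum g) (+-comm (g zero) (g (suc i))) (+-monoʳ-≤ (g zero) (≤-sum (g ∘ suc) i))
+≤-sum g {suc i} {suc j} i≢j = ≤-trans (+≤-sum (g ∘ suc) (i≢j ∘ cong suc)) (m≤n+m _ _)

+-+≤-sum : ∀ {m} (g : Fin m → ℕ) {i j l} → i ≢ j → i ≢ l → j ≢ l → g i + g j + g l ≤ sum g
+-+≤-sum g {zero}  {zero}  {_}     i≢j _   _   = ⊥-elim (i≢j refl)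
+-+≤-sum g {zero}  {suc _} {zero}  _   i≢l _   = ⊥-elim (i≢l refl)
+-+≤-sum g {suc _} {zero}  {zero}  _   _   j≢l = ⊥-elim (j≢l refl)
+-+≤-sum g {zero}  {suc j} {suc l} _   _   j≢l =
  subst (_≤ sum g) (sym (+-assoc (g zero) (g (suc j)) (g (suc l))))
    (+-monoʳ-≤ (g zero) (+≤-sum (g ∘ suc) (j≢l ∘ cong suc)))
+-+≤-sum g {suc i} {zero}  {suc l} _   i≢l _   =
  subst (_≤ sum g) (sym (trans (cong (_+ g (suc l)) (+-comm (g (suc i)) (g zero)))
                               (+-assoc (g zero) (g (suc i)) (g (suc l)))))
    (+-monoʳ-≤ (g zero) (+≤-sum (g ∘ suc) (i≢l ∘ cong suc)))
+-+≤-sum g {suc i} {suc j} {zero}  i≢j _   _   =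
  subst (_≤ sum g) (+-comm (g zero) (g (suc i) + g (suc j)))
    (+-monoʳ-≤ (g zero) (+≤-sum (g ∘ suc) (i≢j ∘ cong suc)))
+-+≤-sum g {suc i} {suc j} {suc l} i≢j i≢l j≢l =
  ≤-trans (+-+≤-sum (g ∘ suc) (i≢j ∘ cong suc) (i≢l ∘ cong suc) (j≢l ∘ cong suc)) (m≤n+m _ _)

m<n+o⇒0<n⊎m<o : ∀ {m} n {o} → m < n + o → 0 < n ⊎ m < o
m<n+o⇒0<n⊎m<o zero    m<o = inj₂ m<o
m<n+o⇒0<n⊎m<o (suc n) _   = inj₁ z<s

∃-positive : ∀ {m} (g : Fin m → ℕ) → 0 < sum g → ∃ λ j → 0 < g j
∃-positive {suc m} g h with m<n+o⇒0<n⊎m<o (g zero) h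
... | inj₁ 0<g₀ = zero , 0<g₀
... | inj₂ 0<Σ  with ∃-positive (g ∘ suc) 0<Σ
...   | j , 0<gj = suc j , 0<gj

∃-other-positive : ∀ {m} (g : Fin m → ℕ) i → g i < sum g → ∃ λ j → j ≢ i × 0 < g j
∃-other-positive g zero h
  with ∃-positive (g ∘ suc) (+-cancelˡ-< (g zero) 0 _ (subst (_< sum g) (sym (+-identityʳ (g zero))) h))
... | j , 0<gj = suc j , (λ ()) , 0<gj
∃-other-positive g (suc i) h with m<n+o⇒0<n⊎m<o (g zero) h
... | inj₁ 0<g₀ = zero , (λ ()) , 0<g₀
... | inj₂ h′   with ∃-other-positive (g ∘ suc) i h′
...   | j , j≢i , 0<gj = suc j , j≢i ∘ Fin.suc-injective , 0<gj

module _ {A : Set} where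

  data BlockChain {m} (f : Fin m → List A) : ℕ → List A → Set where
    []   : ∀ {lo} → BlockChain f lo []
    cons : ∀ {lo y ys} i → lo ≤ toℕ i → y ∈ f i → BlockChain f (toℕ i) ys →
           BlockChain f lo (y ∷ ys)

  data StrictBlockChain {m} (f : Fin m → List A) : ℕ → List A → Set where
    []   : ∀ {lo} → StrictBlockChain f lo []
    cons : ∀ {lo y ys} i → lo ≤ toℕ i → y ∈ f i → StrictBlockChain f (suc (toℕ i)) ys →
           StrictBlockChain f lo (y ∷ ys)

  private
    chain-suc : ∀ {m} {f : Fin (suc m) → List A} {lo ys} →
                BlockChain (f ∘ suc) lo ys → BlockChain f (suc lo) ys
    chain-suc []                 = []
    chain-suc (cons i lo≤i y∈ c) = cons (suc i) (s≤s lo≤i) y∈ (chain-suc c)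

    chain-lower : ∀ {m} {f : Fin m → List A} {lo ys} → BlockChain f lo ys → BlockChain f 0 ys
    chain-lower []              = []
    chain-lower (cons i _ y∈ c) = cons i z≤n y∈ c

    chain-++ : ∀ {m} {f : Fin (suc m) → List A} {ys zs} →
               ys ⊆ f zero → BlockChain f 0 zs → BlockChain f 0 (ys ++ zs)
    chain-++ {ys = []}    _ c = c
    chain-++ {ys = _ ∷ _} s c = cons zero z≤n (to∈ s) (chain-++ (∷ˡ⁻ s) c)

    strict-pred : ∀ {m} {f : Fin (suc m) → List A} {lo ys} →
                  StrictBlockChain f (suc lo) ys → StrictBlockChain (f ∘ suc) lo ys
    strict-pred []                             = []
    strict-pred (cons (suc i) (s≤s lo≤i) y∈ c) = cons i lo≤i y∈ (strict-pred c)

  ⊆concat⇒BlockChain : ∀ {m} (f : Fin m → List A) {ys} →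
                       ys ⊆ concat (tabulate f) → BlockChain f 0 ys
  ⊆concat⇒BlockChain {zero}  f [] = []
  ⊆concat⇒BlockChain {suc m} f s with ⊆-++-split (f zero) s
  ... | _ , _ , refl , s₁ , s₂ =
    chain-++ s₁ (chain-lower (chain-suc (⊆concat⇒BlockChain (f ∘ suc) s₂)))

  StrictBlockChain⇒⊆concat : ∀ {m} (f : Fin m → List A) {lo ys} →
                             StrictBlockChain f lo ys → ys ⊆ concat (tabulate f)
  StrictBlockChain⇒⊆concat f       []                    = minimum _
  StrictBlockChain⇒⊆concat {suc m} f (cons zero _ y∈ c)    =
    ++⁺ (from∈ y∈) (StrictBlockChain⇒⊆concat (f ∘ suc) (strict-pred c))
  StrictBlockChain⇒⊆concat {suc m} f (cons (suc i) _ y∈ c) =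
    ++⁺ (minimum (f zero)) (StrictBlockChain⇒⊆concat (f ∘ suc) (cons i z≤n y∈ (strict-pred c)))

-- Gaps and crossing chords on a cycle

-- On the cycle 0, 1, …, N − 1, walking c steps forward from a reaches b.
data Gap (N a b c : ℕ) : Set where
  ahead  : a < b → a + c ≡ b     → Gap N a b c
  behind : b < a → a + c ≡ N + b → Gap N a b c

gap-exists : ∀ {N a b} → a < N → a ≢ b → ∃ (Gap N a b)
gap-exists {N} {a} {b} a<N a≢b with <-cmp a b
... | tri< a<b _ _ = b ∸ a     , ahead  a<b (m+[n∸m]≡n (<⇒≤ a<b))
... | tri≈ _ a≡b _ = ⊥-elim (a≢b a≡b)
... | tri> _ _ b<a = N + b ∸ a , behind b<a (m+[n∸m]≡n (≤-trans (<⇒≤ a<N) (m≤m+n N b)))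

gap-ahead : ∀ {N a b c} → a < b → Gap N a b c → a + c ≡ b
gap-ahead _   (ahead _ e)    = e
gap-ahead a<b (behind b<a _) = ⊥-elim (<-asym a<b b<a)

gap-behind : ∀ {N a b c} → b < a → Gap N a b c → a + c ≡ N + b
gap-behind b<a (ahead a<b _) = ⊥-elim (<-asym a<b b<a)
gap-behind _   (behind _ e)  = e

private
  round-trip : ∀ {N a b c d} → a + c ≡ b → b + d ≡ N + a → c + d ≡ N
  round-trip {N} {a} {b} {c} {d} a+c≡b b+d≡N+a = +-cancelˡ-≡ a _ _ (begin
    a + (c + d) ≡⟨ +-assoc a c d ⟨
    a + c + d   ≡⟨ cong (_+ d) a+c≡b ⟩
    b + d       ≡⟨ b+d≡N+a ⟩
    N + a       ≡⟨ +-comm N a ⟩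
    a + N       ∎)
    where open ≡-Reasoning

gap-sum : ∀ {N a b c d} → Gap N a b c → Gap N b a d → c + d ≡ N
gap-sum         (ahead  _ a+c≡b)   (behind _ b+d≡N+a) = round-trip a+c≡b b+d≡N+a
gap-sum {c = c} (behind _ a+c≡N+b) (ahead  _ b+d≡a)   = trans (+-comm c _) (round-trip b+d≡a a+c≡N+b)
gap-sum         (ahead  a<b _)     (ahead  b<a _)     = ⊥-elim (<-asym a<b b<a)
gap-sum         (behind b<a _)     (behind a<b _)     = ⊥-elim (<-asym a<b b<a)

gap-self-inverse : ∀ {k a b c} → Gap (k + k) a b c → Gap (k + k) b a c → c ≡ k
gap-self-inverse {k} {c = c} g g′ = begin
  c           ≡⟨ n≡⌊n+n/2⌋ c ⟩
  ⌊ c + c /2⌋ ≡⟨ cong ⌊_/2⌋ (gap-sum g g′) ⟩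
  ⌊ k + k /2⌋ ≡⟨ n≡⌊n+n/2⌋ k ⟨
  k           ∎
  where open ≡-Reasoning

SamePair : ℕ → ℕ → ℕ → ℕ → Set
SamePair i i′ a a′ = (i ≡ a × i′ ≡ a′) ⊎ (i ≡ a′ × i′ ≡ a)

Interleave : ℕ → ℕ → ℕ → ℕ → Set
Interleave a a′ b b′ = ∃₂ λ i i′ → ∃₂ λ j j′ →
  SamePair i i′ a a′ × SamePair j j′ b b′ × i < j × j < i′ × i′ < j′

Crossing : ℕ → ℕ → ℕ → ℕ → Set
Crossing a a′ b b′ = Interleave a a′ b b′ ⊎ Interleave b b′ a a′

-- A chord from t can only cross a chord from t + 1 if the cyclic order is t, t + 1, p, q.
crossing-gap-step : ∀ {N t p q c₁ c₂} → p < N → Crossing t p (suc t) q →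
                    Gap N t p c₁ → Gap N (suc t) q c₂ → c₁ ≤ c₂
crossing-gap-step {N} {t} {p} {q} {c₁} {c₂} p<N crossing g₁ g₂ =
  +-cancelˡ-≤ t c₁ c₂ (≤-pred (shifted crossing))
  where
  shifted : Crossing t p (suc t) q → t + c₁ < suc t + c₂
  shifted (inj₁ (_ , _ , _ , _ , inj₁ (refl , refl) , inj₁ (refl , refl) , _ , t+1<p , p<q)) =
    subst₂ _<_ (sym (gap-ahead (<-trans (n<1+n t) t+1<p) g₁)) (sym (gap-ahead (<-trans t+1<p p<q) g₂)) p<q
  shifted (inj₁ (_ , _ , _ , _ , inj₁ (refl , refl) , inj₂ (refl , refl) , t<q , q<p , p<t+1)) =
    ⊥-elim (<⇒≱ (<-trans t<q q<p) (≤-pred p<t+1))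
  shifted (inj₁ (_ , _ , _ , _ , inj₂ (refl , refl) , inj₁ (refl , refl) , _ , t+1<t , _)) =
    ⊥-elim (<-asym t+1<t (n<1+n t))
  shifted (inj₁ (_ , _ , _ , _ , inj₂ (refl , refl) , inj₂ (refl , refl) , p<q , q<t , _)) =
    subst₂ _<_ (sym (gap-behind (<-trans p<q q<t) g₁)) (sym (gap-behind (<-trans q<t (n<1+n t)) g₂))
      (+-monoʳ-< N p<q)
  shifted (inj₂ (_ , _ , _ , _ , inj₁ (refl , refl) , inj₁ (refl , refl) , t+1<t , _ , _)) =
    ⊥-elim (<-asym t+1<t (n<1+n t))
  shifted (inj₂ (_ , _ , _ , _ , inj₁ (refl , refl) , inj₂ (refl , refl) , t+1<p , p<q , q<t)) =
    ⊥-elim (<-asym (<-trans t+1<p (<-trans p<q q<t)) (n<1+n t))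
  shifted (inj₂ (_ , _ , _ , _ , inj₂ (refl , refl) , inj₁ (refl , refl) , q<t , _ , t+1<p)) =
    subst₂ _<_ (sym (gap-ahead (<-trans (n<1+n t) t+1<p) g₁)) (sym (gap-behind (<-trans q<t (n<1+n t)) g₂))
      (<-≤-trans p<N (m≤m+n N q))
  shifted (inj₂ (_ , _ , _ , _ , inj₂ (refl , refl) , inj₂ (refl , refl) , _ , _ , t+1<t)) =
    ⊥-elim (<-asym t+1<t (n<1+n t))

crossing-gap-wrap : ∀ {L p q c₁ c₂} → p < suc L → Crossing L p 0 q →
                    Gap (suc L) L p c₁ → Gap (suc L) 0 q c₂ → c₁ ≤ c₂
crossing-gap-wrap _ (inj₁ (_ , _ , _ , _ , _ , inj₁ (refl , refl) , i<0 , _ , _)) _ _ = ⊥-elim (n≮0 i<0)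
crossing-gap-wrap _ (inj₁ (_ , _ , _ , _ , _ , inj₂ (refl , refl) , _ , _ , i′<0)) _ _ = ⊥-elim (n≮0 i′<0)
crossing-gap-wrap _ (inj₂ (_ , _ , _ , _ , inj₂ (refl , refl) , _ , _ , j<0 , _)) _ _ = ⊥-elim (n≮0 j<0)
crossing-gap-wrap p<1+L (inj₂ (_ , _ , _ , _ , inj₁ (refl , refl) , inj₁ (refl , refl) , _ , L<q , q<p)) _ _ =
  ⊥-elim (<⇒≱ (<-trans L<q q<p) (≤-pred p<1+L))
crossing-gap-wrap {L} {p} _
  (inj₂ (_ , _ , _ , _ , inj₁ (refl , refl) , inj₂ (refl , refl) , 0<p , p<q , q<L)) g₁ g₂ =
  subst₂ _≤_ 1+p≡c₁ (sym (gap-ahead (<-trans 0<p p<q) g₂)) p<q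
  where
  1+p≡c₁ = +-cancelˡ-≡ L _ _ (trans (+-suc L p) (sym (gap-behind (<-trans p<q q<L) g₁)))

opp≡join∘swap∘splitAt : ∀ k i → opp k i ≡ join k k (swap (splitAt k i))
opp≡join∘swap∘splitAt k i with splitAt k i
... | inj₁ _ = refl
... | inj₂ _ = refl

opp-involutive : ∀ k i → opp k (opp k i) ≡ i
opp-involutive k i = begin
  opp k (opp k i)                            ≡⟨ opp≡join∘swap∘splitAt k (opp k i) ⟩
  join k k (swap (splitAt k (opp k i)))      ≡⟨ cong (join k k ∘ swap ∘ splitAt k) (opp≡join∘swap∘splitAt k i) ⟩
  join k k (swap (splitAt k (join k k s′)))  ≡⟨ cong (join k k ∘ swap) (Fin.splitAt-join k k s′) ⟩
  join k k (swap (swap (splitAt k i)))       ≡⟨ cong (join k k) (swap-involutive (splitAt k i)) ⟩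
  join k k (splitAt k i)                     ≡⟨ Fin.join-splitAt k k i ⟩
  i                                          ∎
  where
  open ≡-Reasoning
  s′ = swap (splitAt k i)

opp-swap : ∀ k {a b : Fin (k + k)} → a ≡ opp k b → b ≡ opp k a
opp-swap k {b = b} e = trans (sym (opp-involutive k b)) (cong (opp k) (sym e))

opp-pair-unique : ∀ k {a i j : Fin (k + k)} →
                  a ≡ i ⊎ a ≡ opp k i → a ≡ j ⊎ a ≡ opp k j → j ≡ i ⊎ j ≡ opp k i
opp-pair-unique k         (inj₁ refl) (inj₁ a≡j)  = inj₁ (sym a≡j)
opp-pair-unique k         (inj₁ refl) (inj₂ a≡j′) = inj₂ (opp-swap k a≡j′)
opp-pair-unique k         (inj₂ refl) (inj₁ a≡j)  = inj₂ (sym a≡j)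
opp-pair-unique k {i = i} (inj₂ refl) (inj₂ a≡j′) = inj₁ (trans (opp-swap k a≡j′) (opp-involutive k i))

toℕ-opp : ∀ k (i : Fin (k + k)) →
          (toℕ i < k × toℕ (opp k i) ≡ toℕ i + k) ⊎ (k ≤ toℕ i × toℕ (opp k i) + k ≡ toℕ i)
toℕ-opp k i with splitAt k i in eq
... | inj₁ a with refl ← Fin.splitAt⁻¹-↑ˡ eq rewrite Fin.toℕ-↑ˡ a k | Fin.toℕ-↑ʳ k a =
  inj₁ (Fin.toℕ<n a , +-comm k (toℕ a))
... | inj₂ b with refl ← Fin.splitAt⁻¹-↑ʳ eq rewrite Fin.toℕ-↑ˡ b k | Fin.toℕ-↑ʳ k b =
  inj₂ (m≤m+n k (toℕ b) , +-comm (toℕ b) k)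

toℕ-opp-< : ∀ {k} {a : Fin (k + k)} → toℕ a < k → toℕ (opp k a) ≡ toℕ a + k
toℕ-opp-< {k} {a} a<k with toℕ-opp k a
... | inj₁ (_ , e)   = e
... | inj₂ (k≤a , _) = ⊥-elim (<⇒≱ a<k k≤a)

opp-representative : ∀ k (i : Fin (k + k)) → ∃ λ a → toℕ a < k × (a ≡ i ⊎ a ≡ opp k i)
opp-representative k i with toℕ-opp k i
... | inj₁ (i<k , _) = i , i<k , inj₁ refl
... | inj₂ (_ , e)   = opp k i , +-cancelʳ-< k _ k (subst (_< k + k) (sym e) (Fin.toℕ<n i)) , inj₂ refl

gap-half⇒opp : ∀ {k} (a b : Fin (k + k)) → Gap (k + k) (toℕ a) (toℕ b) k → b ≡ opp k a
gap-half⇒opp {k} a b g = Fin.toℕ-injective (from-gap g (toℕ-opp k a))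
  where
  from-gap : Gap (k + k) (toℕ a) (toℕ b) k → _ → toℕ b ≡ toℕ (opp k a)
  from-gap (ahead  _ a+k≡b) (inj₁ (_ , e)) = trans (sym a+k≡b) (sym e)
  from-gap (behind _ a+k≡N+b) (inj₂ (_ , e)) = +-cancelʳ-≡ k _ _ (trans b+k≡a (sym e))
    where
    b+k≡a : toℕ b + k ≡ toℕ a
    b+k≡a = +-cancelʳ-≡ k _ _ (begin
      toℕ b + k + k   ≡⟨ +-assoc (toℕ b) k k ⟩
      toℕ b + (k + k) ≡⟨ +-comm (toℕ b) (k + k) ⟩
      k + k + toℕ b   ≡⟨ a+k≡N+b ⟨
      toℕ a + k       ∎)
      where open ≡-Reasoning
  from-gap (ahead _ a+k≡b) (inj₂ (k≤a , _)) =
    ⊥-elim (<⇒≱ (subst (_< k + k) (sym a+k≡b) (Fin.toℕ<n b)) (+-monoˡ-≤ k k≤a))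
  from-gap (behind _ a+k≡N+b) (inj₁ (a<k , _)) =
    ⊥-elim (<⇒≱ (+-monoˡ-< k a<k) (subst (k + k ≤_) (sym a+k≡N+b) (m≤m+n (k + k) (toℕ b))))

1<m+m : ∀ {m} → Fin (m + m) → 1 < m + m
1<m+m {suc m} _ = s≤s (≤-trans (s≤s z≤n) (m≤n+m (suc m) m))

last-index : ∀ {m} → Fin m → ∃ λ (l : Fin m) → suc (toℕ l) ≡ m
last-index {suc m} _ = fromℕ m , cong suc (Fin.toℕ-fromℕ m)

first-index : ∀ {m} → Fin m → ∃ λ (f : Fin m) → toℕ f ≡ 0
first-index {suc m} _ = zero , refl

%2≡0⊎%2≡1 : ∀ m → m % 2 ≡ 0 ⊎ m % 2 ≡ 1
%2≡0⊎%2≡1 zero          = inj₁ refl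
%2≡0⊎%2≡1 (suc zero)    = inj₂ refl
%2≡0⊎%2≡1 (suc (suc m)) = %2≡0⊎%2≡1 m

[m+m]%2≡0 : ∀ m → (m + m) % 2 ≡ 0
[m+m]%2≡0 zero    = refl
[m+m]%2≡0 (suc m) rewrite +-suc m m = [m+m]%2≡0 m

sideOf : ℕ → Part
sideOf zero    = pA
sideOf (suc _) = pB

sideOf-%2-suc : ∀ m → sideOf (m % 2) ≢ sideOf (suc m % 2)
sideOf-%2-suc zero          = λ ()
sideOf-%2-suc (suc zero)    = λ ()
sideOf-%2-suc (suc (suc m)) = sideOf-%2-suc m

-- The blocks of a split in a circle representation

module SplitBlocks {n : ℕ} (G : Graph n) (part : Fin n → Part) (split : IsSplit G part)
  (τ : List (Fin n)) (rep : CircleRep G τ) (k : ℕ) (blocks : Fin (k + k) → List (Fin n))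
  (bd : BlockDecomp part (induced part τ) k blocks) where

  open CircleRep rep
  open BlockDecomp bd

  N : ℕ
  N = k + k

  γ w : List (Fin n)
  γ = induced part τ
  w = concat (tabulate blocks)

  r : ℕ
  r = proj₁ circ

  rotate-γ≡w : rotate r γ ≡ w
  rotate-γ≡w = proj₂ circ

  side : Fin N → Part
  side i = sideOf (toℕ i % 2)

  side≡pA⊎pB : ∀ i → side i ≡ pA ⊎ side i ≡ pB
  side≡pA⊎pB i with toℕ i % 2
  ... | zero  = inj₁ refl
  ... | suc _ = inj₂ refl

  side-fromℕ< : ∀ {m} (m<N : m < N) → side (fromℕ< m<N) ≡ sideOf (m % 2)
  side-fromℕ< m<N = cong (λ m → sideOf (m % 2)) (Fin.toℕ-fromℕ< m<N)

  consecutive-sides≢ : ∀ t t′ → suc (toℕ t) % 2 ≡ toℕ t′ % 2 → side t ≢ side t′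
  consecutive-sides≢ t t′ e = subst (λ m → side t ≢ sideOf m) e (sideOf-%2-suc (toℕ t))

  other-side-block : ∀ t → ∃ λ t′ → side t ≢ side t′
  other-side-block t with side≡pA⊎pB t
  ... | inj₁ tA = fromℕ< 1<N , λ e → case trans (sym tA) (trans e (side-fromℕ< 1<N)) of λ ()
    where 1<N = 1<m+m {k} t
  ... | inj₂ tB = fromℕ< 0<N , λ e → case trans (sym tB) (trans e (side-fromℕ< 0<N)) of λ ()
    where 0<N = <-trans z<s (1<m+m {k} t)

  block-side : ∀ {x i} → x ∈ blocks i → part x ≡ side i
  block-side {x} {i} x∈ with %2≡0⊎%2≡1 (toℕ i)
  ... | inj₁ e rewrite e = evenA i e x x∈
  ... | inj₂ e rewrite e = oddB i e x x∈

  block-part : ∀ {x i} → x ∈ blocks i → part x ≡ pA ⊎ part x ≡ pB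
  block-part {i = i} x∈ with side≡pA⊎pB i
  ... | inj₁ e = inj₁ (trans (block-side x∈) e)
  ... | inj₂ e = inj₂ (trans (block-side x∈) e)

  block-inAB : ∀ {x i} → x ∈ blocks i → T (inAB (part x))
  block-inAB x∈ with block-part x∈
  ... | inj₁ e rewrite e = tt
  ... | inj₂ e rewrite e = tt

  sides≢⇒parts≢ : ∀ {x y i j} → x ∈ blocks i → y ∈ blocks j → side i ≢ side j → part x ≢ part y
  sides≢⇒parts≢ x∈ y∈ i≁j x∼y = i≁j (trans (sym (block-side x∈)) (trans x∼y (block-side y∈)))

  parts≢⇒blocks≢ : ∀ {x y i j} → x ∈ blocks i → y ∈ blocks j → part x ≢ part y → i ≢ j
  parts≢⇒blocks≢ x∈ y∈ x≁y refl = x≁y (trans (block-side x∈) (sym (block-side y∈)))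

  block-element : ∀ i → ∃ (_∈ blocks i)
  block-element i with blocks i | nonempty i
  ... | []    | ≢[] = ⊥-elim (≢[] refl)
  ... | y ∷ _ | _   = y , here refl

  opposite-sides⇒Adj : ∀ {x y i j} → x ∈ blocks i → y ∈ blocks j → part x ≢ part y → Adj G x y
  opposite-sides⇒Adj {x} {y} x∈ y∈ x≁y with block-part x∈ | block-part y∈
  ... | inj₁ xA | inj₂ yB = IsSplit.complete split x y xA yB
  ... | inj₂ xB | inj₁ yA = Graph.sym G (IsSplit.complete split y x yA xB)
  ... | inj₁ xA | inj₁ yA = ⊥-elim (x≁y (trans xA (sym yA)))
  ... | inj₂ xB | inj₂ yB = ⊥-elim (x≁y (trans xB (sym yB)))

  Adj⇒Alternating : ∀ {x y i j} → x ∈ blocks i → y ∈ blocks j → Adj G x y → Alternating w x y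
  Adj⇒Alternating {x} {y} x∈ y∈ xy = subst (λ ws → Alternating ws x y) rotate-γ≡w
    (Alternating-rotate⁺ r γ (Alternating-filterᵇ⁺ (inAB ∘ part) {τ} (block-inAB x∈) (block-inAB y∈)
      (Alternate⇒Alternating {τ = τ} (Equivalence.to (edges x y) xy))))

  Alternating⇒Adj : ∀ {x y} → Alternating w x y → Adj G x y
  Alternating⇒Adj {x} {y} alt = Equivalence.from (edges x y)
    (Alternating⇒Alternate {τ = τ} (Alternating-filterᵇ⁻ (inAB ∘ part) {τ}
      (Alternating-rotate⁻ r γ (subst (λ ws → Alternating ws x y) (sym rotate-γ≡w) alt))))

  opposite-sides⇒Alternating : ∀ {x y i j} → x ∈ blocks i → y ∈ blocks j → part x ≢ part y →
                               Alternating w x y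
  opposite-sides⇒Alternating x∈ y∈ x≁y = Adj⇒Alternating x∈ y∈ (opposite-sides⇒Adj x∈ y∈ x≁y)

  occ-w≡2 : ∀ {x i} → x ∈ blocks i → occ x w ≡ 2
  occ-w≡2 {x} x∈ = begin
    occ x w            ≡⟨ cong (occ x) rotate-γ≡w ⟨
    occ x (rotate r γ) ≡⟨ occ-rotate x r γ ⟩
    occ x γ            ≡⟨ occ-filterᵇ (inAB ∘ part) (block-inAB x∈) τ ⟩
    occ x τ            ≡⟨ twice x ⟩
    2                  ∎
    where open ≡-Reasoning

  sum-occ-blocks : ∀ {x i} → x ∈ blocks i → sum (λ j → occ x (blocks j)) ≡ 2
  sum-occ-blocks {x} x∈ = trans (sym (occ-concat x blocks)) (occ-w≡2 x∈)

  only-block-of-repeat : ∀ {x t j} → 2 ≤ occ x (blocks t) → x ∈ blocks j → j ≡ t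
  only-block-of-repeat {x} {t} {j} 2≤occ x∈j with j Fin.≟ t
  ... | yes j≡t = j≡t
  ... | no  j≢t = ⊥-elim (<⇒≱ (+-mono-≤ 2≤occ (∈⇒0<occ x∈j))
                   (subst (_ ≤_) (sum-occ-blocks x∈j) (+≤-sum _ (j≢t ∘ sym))))

  repeated-squeeze : ∀ {x y t i j l} → 2 ≤ occ x (blocks t) → x ∈ blocks i → toℕ i ≤ toℕ j →
                     y ∈ blocks j → toℕ j ≤ toℕ l → x ∈ blocks l → y ∈ blocks t
  repeated-squeeze {y = y} 2≤occ x∈i i≤j y∈j j≤l x∈l
    with only-block-of-repeat 2≤occ x∈i | only-block-of-repeat 2≤occ x∈l
  ... | refl | refl = subst (λ b → y ∈ blocks b) (Fin.toℕ-injective (≤-antisym j≤l i≤j)) y∈j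

  repeated⇒between : ∀ {x y t} → 2 ≤ occ x (blocks t) → Alternating w x y → y ∈ blocks t
  repeated⇒between 2≤occ (inj₁ s) with ⊆concat⇒BlockChain blocks s
  ... | cons _ _ x∈₁ (cons _ b₁≤b₂ y∈₂ (cons _ b₂≤b₃ x∈₃ _)) =
    repeated-squeeze 2≤occ x∈₁ b₁≤b₂ y∈₂ b₂≤b₃ x∈₃
  repeated⇒between 2≤occ (inj₂ s) with ⊆concat⇒BlockChain blocks s
  ... | cons _ _ _ (cons _ _ x∈₂ (cons _ b₂≤b₃ y∈₃ (cons _ b₃≤b₄ x∈₄ _))) =
    repeated-squeeze 2≤occ x∈₂ b₂≤b₃ y∈₃ b₃≤b₄ x∈₄

  occ-block≤1 : ∀ t x → occ x (blocks t) ≤ 1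
  occ-block≤1 t x with occ x (blocks t) ≤? 1
  ... | yes occ≤1 = occ≤1
  ... | no  occ≰1 with other-side-block t
  ...   | t′ , t≁t′ with block-element t′
  ...     | y , y∈t′ = ⊥-elim (t≁t′ (trans (sym (block-side y∈t)) (block-side y∈t′)))
    where
    2≤occ = ≰⇒> occ≰1
    x∈t = 0<occ⇒∈ (blocks t) (≤-trans (s≤s z≤n) 2≤occ)
    y∈t = repeated⇒between 2≤occ (opposite-sides⇒Alternating x∈t y∈t′ (sides≢⇒parts≢ x∈t y∈t′ t≁t′))

  block-Unique : ∀ i → Unique (blocks i)
  block-Unique i = occ≤1⇒Unique (blocks i) (λ x → occ-block≤1 i x)

  other-block : ∀ {x t} → x ∈ blocks t → ∃ λ p → x ∈ blocks p × p ≢ t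
  other-block {x} {t} x∈t with ∃-other-positive (λ j → occ x (blocks j)) t
    (subst (occ x (blocks t) <_) (sym (sum-occ-blocks x∈t)) (s≤s (occ-block≤1 t x)))
  ... | p , p≢t , 0<occ = p , 0<occ⇒∈ (blocks p) 0<occ , p≢t

  in-two-blocks : ∀ {x t p j} → x ∈ blocks t → x ∈ blocks p → p ≢ t → x ∈ blocks j → j ≡ t ⊎ j ≡ p
  in-two-blocks {x} {t} {p} {j} x∈t x∈p p≢t x∈j with j Fin.≟ t | j Fin.≟ p
  ... | yes j≡t | _       = inj₁ j≡t
  ... | no  _   | yes j≡p = inj₂ j≡p
  ... | no  j≢t | no  j≢p = ⊥-elim (<⇒≱
    (+-mono-≤ (+-mono-≤ (∈⇒0<occ x∈t) (∈⇒0<occ x∈p)) (∈⇒0<occ x∈j))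
    (subst (_ ≤_) (sum-occ-blocks x∈t) (+-+≤-sum _ (p≢t ∘ sym) (j≢t ∘ sym) (j≢p ∘ sym))))

  same-pair : ∀ {x t p i i′} → x ∈ blocks t → x ∈ blocks p → p ≢ t → x ∈ blocks i → x ∈ blocks i′ →
              toℕ i < toℕ i′ → SamePair (toℕ i) (toℕ i′) (toℕ t) (toℕ p)
  same-pair x∈t x∈p p≢t x∈i x∈i′ i<i′
    with in-two-blocks x∈t x∈p p≢t x∈i | in-two-blocks x∈t x∈p p≢t x∈i′
  ... | inj₁ refl | inj₂ refl = inj₁ (refl , refl)
  ... | inj₂ refl | inj₁ refl = inj₂ (refl , refl)
  ... | inj₁ refl | inj₁ refl = ⊥-elim (<-irrefl refl i<i′)
  ... | inj₂ refl | inj₂ refl = ⊥-elim (<-irrefl refl i<i′)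

  blocks-cross : ∀ {x y t p s q} → x ∈ blocks t → x ∈ blocks p → p ≢ t →
                 y ∈ blocks s → y ∈ blocks q → q ≢ s →
                 part x ≢ part y → Crossing (toℕ t) (toℕ p) (toℕ s) (toℕ q)
  blocks-cross {x} {y} x∈t x∈p p≢t y∈s y∈q q≢s x≁y = crossing (opposite-sides⇒Alternating x∈t y∈s x≁y)
    where
    separate : ∀ {u v i j} → u ∈ blocks i → v ∈ blocks j → part u ≢ part v →
               toℕ i ≤ toℕ j → toℕ i < toℕ j
    separate u∈ v∈ u≁v i≤j = ≤∧≢⇒< i≤j (parts≢⇒blocks≢ u∈ v∈ u≁v ∘ Fin.toℕ-injective)
    y≁x = x≁y ∘ sym
    crossing : Alternating w x y → Crossing _ _ _ _
    crossing (inj₁ s) with ⊆concat⇒BlockChain blocks s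
    ... | cons _ _ x∈₁ (cons _ b₁≤b₂ y∈₂ (cons _ b₂≤b₃ x∈₃ (cons _ b₃≤b₄ y∈₄ []))) =
      let b₁<b₂ = separate x∈₁ y∈₂ x≁y b₁≤b₂
          b₂<b₃ = separate y∈₂ x∈₃ y≁x b₂≤b₃
          b₃<b₄ = separate x∈₃ y∈₄ x≁y b₃≤b₄
      in inj₁ (_ , _ , _ , _ , same-pair x∈t x∈p p≢t x∈₁ x∈₃ (<-trans b₁<b₂ b₂<b₃) ,
               same-pair y∈s y∈q q≢s y∈₂ y∈₄ (<-trans b₂<b₃ b₃<b₄) , b₁<b₂ , b₂<b₃ , b₃<b₄)
    crossing (inj₂ s) with ⊆concat⇒BlockChain blocks s
    ... | cons _ _ y∈₁ (cons _ b₁≤b₂ x∈₂ (cons _ b₂≤b₃ y∈₃ (cons _ b₃≤b₄ x∈₄ []))) =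
      let b₁<b₂ = separate y∈₁ x∈₂ y≁x b₁≤b₂
          b₂<b₃ = separate x∈₂ y∈₃ x≁y b₂≤b₃
          b₃<b₄ = separate y∈₃ x∈₄ y≁x b₃≤b₄
      in inj₂ (_ , _ , _ , _ , same-pair y∈s y∈q q≢s y∈₁ y∈₃ (<-trans b₁<b₂ b₂<b₃) ,
               same-pair x∈t x∈p p≢t x∈₂ x∈₄ (<-trans b₂<b₃ b₃<b₄) , b₁<b₂ , b₂<b₃ , b₃<b₄)

  SymbolGap : Fin n → Fin N → ℕ → Set
  SymbolGap y s c = ∃ λ q → y ∈ blocks s × y ∈ blocks q × q ≢ s × Gap N (toℕ s) (toℕ q) c

  symbolGap-exists : ∀ {y s} → y ∈ blocks s → ∃ (SymbolGap y s)
  symbolGap-exists {y} {s} y∈s with other-block y∈s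
  ... | q , y∈q , q≢s with gap-exists (Fin.toℕ<n s) (q≢s ∘ sym ∘ Fin.toℕ-injective)
  ...   | c , g = c , q , y∈s , y∈q , q≢s , g

  block-gap : ∀ s → ∃₂ λ y c → SymbolGap y s c
  block-gap s = let y , y∈s = block-element s in y , symbolGap-exists y∈s

  symbolGap-step : ∀ {x y t t′ c₁ c₂} → toℕ t′ ≡ suc (toℕ t) →
                   SymbolGap x t c₁ → SymbolGap y t′ c₂ → c₁ ≤ c₂
  symbolGap-step {t = t} {t′} {c₂ = c₂} e (p , x∈t , x∈p , p≢t , g₁) (q , y∈t′ , y∈q , q≢t′ , g₂) =
    crossing-gap-step (Fin.toℕ<n p)
      (subst (λ m → Crossing (toℕ t) (toℕ p) m (toℕ q)) e (blocks-cross x∈t x∈p p≢t y∈t′ y∈q q≢t′ x≁y))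
      g₁ (subst (λ m → Gap N m (toℕ q) c₂) e g₂)
    where
    x≁y = sides≢⇒parts≢ x∈t y∈t′ (consecutive-sides≢ t t′ (cong (_% 2) (sym e)))

  symbolGap-wrap : ∀ {x y t t′ c₁ c₂} → suc (toℕ t) ≡ N → toℕ t′ ≡ 0 →
                   SymbolGap x t c₁ → SymbolGap y t′ c₂ → c₁ ≤ c₂
  symbolGap-wrap {t = t} {t′} {c₁} {c₂} e e′ (p , x∈t , x∈p , p≢t , g₁) (q , y∈t′ , y∈q , q≢t′ , g₂) =
    crossing-gap-wrap (subst (toℕ p <_) (sym e) (Fin.toℕ<n p))
      (subst (λ m → Crossing (toℕ t) (toℕ p) m (toℕ q)) e′ (blocks-cross x∈t x∈p p≢t y∈t′ y∈q q≢t′ x≁y))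
      (subst (λ M → Gap M (toℕ t) (toℕ p) c₁) (sym e) g₁)
      (subst₂ (λ M m → Gap M m (toℕ q) c₂) (sym e) e′ g₂)
    where
    N-even : suc (toℕ t) % 2 ≡ toℕ t′ % 2
    N-even = trans (cong (_% 2) e) (trans ([m+m]%2≡0 k) (sym (cong (_% 2) e′)))
    x≁y = sides≢⇒parts≢ x∈t y∈t′ (consecutive-sides≢ t t′ N-even)

  symbolGap-chain : ∀ d {y z s s′ c₁ c₂} → toℕ s′ ≡ suc (d + toℕ s) →
                    SymbolGap y s c₁ → SymbolGap z s′ c₂ → c₁ ≤ c₂
  symbolGap-chain zero    e g₁ g₂ = symbolGap-step e g₁ g₂
  symbolGap-chain (suc d) {s = s} {s′} e g₁ g₂ =
    ≤-trans (symbolGap-chain d (Fin.toℕ-fromℕ< m<N) g₁ gₘ) (symbolGap-step e′ gₘ g₂)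
    where
    m<N : suc (d + toℕ s) < N
    m<N = <-trans (n<1+n _) (subst (_< N) e (Fin.toℕ<n s′))
    gₘ = proj₂ (proj₂ (block-gap (fromℕ< m<N)))
    e′ : toℕ s′ ≡ suc (toℕ (fromℕ< m<N))
    e′ = trans e (cong suc (sym (Fin.toℕ-fromℕ< m<N)))

  symbolGap-< : ∀ {y z s s′ c₁ c₂} → toℕ s < toℕ s′ → SymbolGap y s c₁ → SymbolGap z s′ c₂ → c₁ ≤ c₂
  symbolGap-< {s = s} {s′} s<s′ =
    symbolGap-chain d (sym (trans (cong suc (+-comm d (toℕ s))) (m+[n∸m]≡n s<s′)))
    where d = toℕ s′ ∸ suc (toℕ s)

  symbolGap-later : ∀ {y s s′ c} → toℕ s ≤ toℕ s′ → SymbolGap y s c →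
                    ∃₂ λ z c′ → SymbolGap z s′ c′ × c ≤ c′
  symbolGap-later {s′ = s′} s≤s′ g with m≤n⇒m<n∨m≡n s≤s′
  ... | inj₁ s<s′ = let z , c′ , g′ = block-gap s′ in z , c′ , g′ , symbolGap-< s<s′ g g′
  ... | inj₂ s≡s′ = _ , _ , subst (λ b → SymbolGap _ b _) (Fin.toℕ-injective s≡s′) g , ≤-refl

  symbolGap-earlier : ∀ {z s s′ c} → toℕ s ≤ toℕ s′ → SymbolGap z s′ c →
                      ∃₂ λ y c′ → SymbolGap y s c′ × c′ ≤ c
  symbolGap-earlier {s = s} s≤s′ g with m≤n⇒m<n∨m≡n s≤s′
  ... | inj₁ s<s′ = let y , c′ , g′ = block-gap s in y , c′ , g′ , symbolGap-< s<s′ g′ g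
  ... | inj₂ s≡s′ = _ , _ , subst (λ b → SymbolGap _ b _) (sym (Fin.toℕ-injective s≡s′)) g , ≤-refl

  -- Up from s to the last block, across to block 0, then up to s′.
  symbolGap-≤ : ∀ {y z s s′ c₁ c₂} → SymbolGap y s c₁ → SymbolGap z s′ c₂ → c₁ ≤ c₂
  symbolGap-≤ {s = s} {s′} g₁ g₂ with last-index s | first-index s
  ... | L , 1+L≡N | F , F≡0
    with symbolGap-later s≤L g₁ | symbolGap-earlier (subst (_≤ toℕ s′) (sym F≡0) z≤n) g₂
    where s≤L = ≤-pred (subst (toℕ s <_) (sym 1+L≡N) (Fin.toℕ<n s))
  ...   | _ , _ , g_L , c₁≤ | _ , _ , g_F , ≤c₂ =
    ≤-trans c₁≤ (≤-trans (symbolGap-wrap 1+L≡N F≡0 g_L g_F) ≤c₂)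

  block⊆opposite : ∀ {x t} → x ∈ blocks t → x ∈ blocks (opp k t)
  block⊆opposite {x} {t} x∈t with symbolGap-exists x∈t
  ... | c , p , _ , x∈p , p≢t , g with gap-exists (Fin.toℕ<n p) (p≢t ∘ Fin.toℕ-injective)
  ...   | c′ , g′ = subst (λ b → x ∈ blocks b) (gap-half⇒opp t p (subst (Gap N _ _) c≡k g)) x∈p
    where
    forth : SymbolGap x t c
    forth = p , x∈t , x∈p , p≢t , g
    back : SymbolGap x p c′
    back = t , x∈p , x∈t , p≢t ∘ sym , g′
    c≡k : c ≡ k
    c≡k = gap-self-inverse g
      (subst (Gap N _ _) (≤-antisym (symbolGap-≤ back forth) (symbolGap-≤ forth back)) g′)

  block⇔opposite : ∀ i x → (x ∈ blocks i) ⇔ (x ∈ blocks (opp k i))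
  block⇔opposite i x = mk⇔ block⊆opposite
    (λ x∈ → subst (λ b → x ∈ blocks b) (opp-involutive k i) (block⊆opposite x∈))

  in-both : ∀ {x i a} → x ∈ blocks i → a ≡ i ⊎ a ≡ opp k i → x ∈ blocks a × x ∈ blocks (opp k a)
  in-both         x∈ (inj₁ refl) = x∈ , block⊆opposite x∈
  in-both {x} {i} x∈ (inj₂ refl) =
    block⊆opposite x∈ , subst (λ b → x ∈ blocks b) (sym (opp-involutive k i)) x∈

  interleaved⇒Adj : ∀ {x y a b} → toℕ a < toℕ b → toℕ b < k →
                    x ∈ blocks a → x ∈ blocks (opp k a) → y ∈ blocks b → y ∈ blocks (opp k b) → Adj G x y
  interleaved⇒Adj {a = a} {b} a<b b<k x∈a x∈a′ y∈b y∈b′ =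
    Alternating⇒Adj (inj₁ (StrictBlockChain⇒⊆concat blocks
      (cons a z≤n x∈a (cons b a<b y∈b (cons (opp k a) b<a+k x∈a′ (cons (opp k b) a+k<b+k y∈b′ []))))))
    where
    a<k = <-trans a<b b<k
    b<a+k : toℕ b < toℕ (opp k a)
    b<a+k = subst (toℕ b <_) (sym (toℕ-opp-< a<k)) (<-≤-trans b<k (m≤n+m k (toℕ a)))
    a+k<b+k : toℕ (opp k a) < toℕ (opp k b)
    a+k<b+k = subst₂ _<_ (sym (toℕ-opp-< a<k)) (sym (toℕ-opp-< b<k)) (+-monoˡ-< k a<b)

  blocks-adjacent : ∀ i j → j ≢ i → j ≢ opp k i → ∀ x y → x ∈ blocks i → y ∈ blocks j → Adj G x y
  blocks-adjacent i j j≢i j≢i′ x y x∈i y∈j with opp-representative k i | opp-representative k j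
  ... | a , a<k , a~i | b , b<k , b~j with in-both x∈i a~i | in-both y∈j b~j | <-cmp (toℕ a) (toℕ b)
  ...   | x∈a , x∈a′ | y∈b , y∈b′ | tri< a<b _ _ = interleaved⇒Adj a<b b<k x∈a x∈a′ y∈b y∈b′
  ...   | x∈a , x∈a′ | y∈b , y∈b′ | tri> _ _ b<a = Graph.sym G (interleaved⇒Adj b<a a<k y∈b y∈b′ x∈a x∈a′)
  ...   | _ | _ | tri≈ _ a≡b _ = ⊥-elim ([ j≢i , j≢i′ ]′ (opp-pair-unique k a~i a~j))
    where a~j = subst (λ c → c ≡ j ⊎ c ≡ opp k j) (sym (Fin.toℕ-injective a≡b)) b~j


mainTheorem1 : ∀ {n : ℕ} (G : Graph n) → Connected G →
    (part : Fin n → Part) → IsSplit G part →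
    (τ : List (Fin n)) → CircleRep G τ →
    (k : ℕ) (blocks : Fin (k + k) → List (Fin n)) →
    BlockDecomp part (induced part τ) k blocks →
    (∀ i → Unique (blocks i))
    × (∀ i x → (x ∈ blocks i) ⇔ (x ∈ blocks (opp k i)))
    × (∀ i j → j ≢ i → j ≢ opp k i → ∀ x y → x ∈ blocks i → y ∈ blocks j → Adj G x y)
mainTheorem1 G _ part split τ rep k blocks bd = block-Unique , block⇔opposite , blocks-adjacent
  where open SplitBlocks G part split τ rep k blocks bd
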